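{- Let $A$ be a finite alphabet with $|A| = a$, let $n$ be a positive integer, and let $w$ be a universal partial word for $A^n$ with well-defined diamondicity $d$. Then $|w| = a^{n-d} + n - 1$.
   Context: A partial word over $A$ is a finite sequence of characters from $A \cup \{\diamond\}$, where $\diamond \notin A$ is a wild-card symbol; a word over $A$ contains no $\diamond$. $A^n$ denotes the set of words of length $n$ over $A$. For $x = x_1\cdots x_n \in A^n$ and a partial word $w = w_1\cdots w_N$, the position $i$ ($0 \le i \le N-n$) covers $x$ if $x_j = w_{i+j}$ for every $1\le j\le n$ with $w_{i+j}\in A$. A universal partial word for $A^n$ is a partial word $w$ such that every word in $A^n$ is covered by exactly one position of $w$. A window of $w$ is a string $w_{i+1}\cdots w_{i+n}$ of $n$ consecutive characters of $w$. The partial word $w$ has well-defined diamondicity $d$ if every window of $w$ contains exactly $d$ occurrences of $\diamond$. -}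

module Defs where

open import Data.Nat using (ℕ; suc; _+_; _≤_)
open import Data.Fin using (Fin)
open import Data.Maybe using (Maybe; just; nothing; is-nothing)
open import Data.Bool using (Bool; true; false)
open import Data.List using (List; length; take; drop; []; _∷_)
open import Data.List.Relation.Binary.Pointwise using (Pointwise)
open import Data.Vec using (Vec; toList)
open import Data.Unit using (⊤)
open import Data.Product using (Σ; _×_; ∃)
open import Relation.Binary.PropositionalEquality using (_≡_)

-- The alphabet A with |A| = a is modelled as Fin a.
-- A partial word is a list over Maybe (Fin a); nothing is the wild card ◇.
PartialWord : ℕ → Set
PartialWord a = List (Maybe (Fin a))

Word : ℕ → ℕ → Set
Word a n = Vec (Fin a) n

-- The window of length n starting after position i: w_{i+1} ⋯ w_{i+n}.
window : ∀ {a} → ℕ → PartialWord a → ℕ → PartialWord a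
window n w i = take n (drop i w)

Compat : ∀ {a} → Maybe (Fin a) → Fin a → Set
Compat nothing  c = ⊤
Compat (just b) c = b ≡ c

Covers : ∀ {a n} → PartialWord a → ℕ → Word a n → Set
Covers {a} {n} w i x = (i + n ≤ length w) × Pointwise Compat (window n w i) (toList x)

Universal : (a n : ℕ) → PartialWord a → Set
Universal a n w = (x : Word a n) →
  Σ ℕ λ i → Covers w i x × ((j : ℕ) → Covers w j x → j ≡ i)

diamonds : ∀ {a} → PartialWord a → ℕ
diamonds []              = 0
diamonds (nothing ∷ w)   = suc (diamonds w)
diamonds (just _ ∷ w)    = diamonds w

DiamondicityIs : (a n : ℕ) → PartialWord a → ℕ → Set
DiamondicityIs a n w d = (i : ℕ) → i + n ≤ length w → diamonds (window n w i) ≡ d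

-- Read the positions of w as an exact cover of Aⁿ by the windows of w: position i covers
-- exactly a^(diamonds of its window) = a^d words, and every word is covered exactly once.
-- Counting the pairs (position, covered word) in both ways gives (|w| - n + 1) · a^d = aⁿ.
module Submission where

open import Defs
open import Data.Nat using (ℕ; zero; suc; _+_; _∸_; _*_; _^_; _⊓_; _≤_; _<_; s≤s; z≤n; NonZero)
open import Data.Nat.Properties
  using ( +-identityʳ; +-comm; *-assoc; *-identityʳ; *-zeroʳ; *-cancelʳ-≡; ^-distribˡ-+-*; m^n≢0
        ; m∸n+n≡m; m≤n⇒m≤1+n; m≤n⇒m⊓n≡m; m+n≤o⇒n≤o; m+n≤o⇒m≤o∸n; m≤o∸n⇒m+n≤o
        ; +-0-commutativeMonoid )
open import Data.Fin using (Fin; toℕ; fromℕ<; punchIn) renaming (zero to fzero)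
open import Data.Fin.Properties using (punchInᵢ≢i; toℕ<n; toℕ-fromℕ<; toℕ-injective; _≟_)
open import Data.Bool using (_∧_; if_then_else_)
open import Data.Maybe using (Maybe; just; nothing)
open import Data.List using ([]; _∷_; length; take; drop)
open import Data.List.Properties using (length-take; length-drop)
open import Data.List.Relation.Binary.Pointwise using (Pointwise; _∷_)
open import Data.List.Relation.Binary.Pointwise.Properties using (decidable)
open import Data.Vec using ([]; _∷_; toList; replicate)
open import Data.Unit using (tt)
open import Data.Product using (_,_)
open import Function using (_∘_)
open import Relation.Nullary using (Dec; yes; does; ¬_)
open import Relation.Nullary.Decidable using (dec-true; dec-false)
open import Relation.Binary.PropositionalEquality
  using (_≡_; _≢_; refl; sym; trans; cong; subst; subst₂; module ≡-Reasoning)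
open import Algebra.Properties.CommutativeMonoid.Sum +-0-commutativeMonoid
  using (sum; sum-syntax; ∑-comm; sum-remove; sum-cong-≗; sum-replicate-zero)

open ≡-Reasoning

∑-const : ∀ m k → ∑[ i < m ] k ≡ m * k
∑-const zero    k = refl
∑-const (suc m) k = cong (k +_) (∑-const m k)

∑-single : ∀ {m} (f : Fin m → ℕ) i → (∀ j → j ≢ i → f j ≡ 0) → ∑[ j < m ] f j ≡ f i
∑-single {suc m} f i others = begin
  sum f                                ≡⟨ sum-remove f ⟩
  f i + ∑[ j < m ] f (punchIn i j)     ≡⟨ cong (f i +_) ∑others≡0 ⟩
  f i + 0                              ≡⟨ +-identityʳ (f i) ⟩
  f i                                  ∎
  where
  ∑others≡0 : ∑[ j < m ] f (punchIn i j) ≡ 0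
  ∑others≡0 = trans (sum-cong-≗ (λ j → others _ (punchInᵢ≢i i j))) (sum-replicate-zero m)

m+n≤o⇒m<1+o∸n : ∀ {m n o} → m + n ≤ o → m < suc (o ∸ n)
m+n≤o⇒m<1+o∸n {m} m+n≤o = s≤s (m+n≤o⇒m≤o∸n m m+n≤o)

m<1+o∸n⇒m+n≤o : ∀ {m n o} → n ≤ o → m < suc (o ∸ n) → m + n ≤ o
m<1+o∸n⇒m+n≤o {m} n≤o (s≤s m≤o∸n) = m≤o∸n⇒m+n≤o m n≤o m≤o∸n

m*a^d≡a^n⇒m≡a^[n∸d] : ∀ a {m d n} .{{_ : NonZero a}} →
                       d ≤ n → m * a ^ d ≡ a ^ n → m ≡ a ^ (n ∸ d)
m*a^d≡a^n⇒m≡a^[n∸d] a {m} {d} {n} d≤n m*a^d≡a^n =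
  *-cancelʳ-≡ m (a ^ (n ∸ d)) (a ^ d) {{m^n≢0 a d}} (begin
  m * a ^ d            ≡⟨ m*a^d≡a^n ⟩
  a ^ n                ≡⟨ cong (a ^_) (m∸n+n≡m d≤n) ⟨
  a ^ (n ∸ d + d)      ≡⟨ ^-distribˡ-+-* a (n ∸ d) d ⟩
  a ^ (n ∸ d) * a ^ d  ∎)

diamonds≤length : ∀ {a} (p : PartialWord a) → diamonds p ≤ length p
diamonds≤length []            = z≤n
diamonds≤length (nothing ∷ p) = s≤s (diamonds≤length p)
diamonds≤length (just _ ∷ p)  = m≤n⇒m≤1+n (diamonds≤length p)

length-window : ∀ {a} n (w : PartialWord a) i → i + n ≤ length w → length (window n w i) ≡ n
length-window n w i i+n≤N = begin
  length (take n (drop i w))  ≡⟨ length-take n (drop i w) ⟩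
  n ⊓ length (drop i w)       ≡⟨ cong (n ⊓_) (length-drop i w) ⟩
  n ⊓ (length w ∸ i)          ≡⟨ m≤n⇒m⊓n≡m (m+n≤o⇒m≤o∸n n n+i≤N) ⟩
  n                           ∎
  where
  n+i≤N : n + i ≤ length w
  n+i≤N = subst (_≤ length w) (+-comm i n) i+n≤N

diamondicity⇒d≤n : ∀ {a n d} {w : PartialWord a} → n ≤ length w → DiamondicityIs a n w d → d ≤ n
diamondicity⇒d≤n {n = n} {w = w} n≤N diamondicity =
  subst₂ _≤_ (diamondicity 0 n≤N) (length-window n w 0 n≤N) (diamonds≤length (window n w 0))

universal⇒n≤length : ∀ {a n} {w : PartialWord a} → Universal a n w → Word a n → n ≤ length w
universal⇒n≤length universal x with universal x
... | i , (i+n≤N , _) , _ = m+n≤o⇒n≤o i i+n≤N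

module _ {a : ℕ} where

  ∑ʷ : ∀ n → (Word a n → ℕ) → ℕ
  ∑ʷ zero    f = f []
  ∑ʷ (suc n) f = ∑[ c < a ] ∑ʷ n (λ x → f (c ∷ x))

  ∑ʷ-cong : ∀ n {f g : Word a n → ℕ} → (∀ x → f x ≡ g x) → ∑ʷ n f ≡ ∑ʷ n g
  ∑ʷ-cong zero    f≗g = f≗g []
  ∑ʷ-cong (suc n) f≗g = sum-cong-≗ {a} (λ c → ∑ʷ-cong n (f≗g ∘ (c ∷_)))

  ∑ʷ-const : ∀ n k → ∑ʷ n (λ _ → k) ≡ a ^ n * k
  ∑ʷ-const zero    k = sym (+-identityʳ k)
  ∑ʷ-const (suc n) k = begin
    ∑[ c < a ] ∑ʷ n (λ _ → k)  ≡⟨ sum-cong-≗ {a} (λ _ → ∑ʷ-const n k) ⟩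
    ∑[ c < a ] (a ^ n * k)     ≡⟨ ∑-const a (a ^ n * k) ⟩
    a * (a ^ n * k)            ≡⟨ *-assoc a (a ^ n) k ⟨
    a ^ suc n * k              ∎

  ∑-∑ʷ-comm : ∀ {m} n (f : Fin m → Word a n → ℕ) →
              ∑[ i < m ] ∑ʷ n (f i) ≡ ∑ʷ n (λ x → ∑[ i < m ] f i x)
  ∑-∑ʷ-comm zero    f = refl
  ∑-∑ʷ-comm {m} (suc n) f = begin
    ∑[ i < m ] ∑[ c < a ] ∑ʷ n (λ x → f i (c ∷ x))
      ≡⟨ ∑-comm (λ i c → ∑ʷ n (λ x → f i (c ∷ x))) ⟩
    ∑[ c < a ] ∑[ i < m ] ∑ʷ n (λ x → f i (c ∷ x))
      ≡⟨ sum-cong-≗ {a} (λ c → ∑-∑ʷ-comm n (λ i x → f i (c ∷ x))) ⟩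
    ∑[ c < a ] ∑ʷ n (λ x → ∑[ i < m ] f i (c ∷ x))
      ∎

  compat? : (m : Maybe (Fin a)) (c : Fin a) → Dec (Compat m c)
  compat? nothing  c = yes tt
  compat? (just b) c = b ≟ c

  Matches : ∀ {n} → PartialWord a → Word a n → Set
  Matches p x = Pointwise Compat p (toList x)

  matches? : ∀ {n} (p : PartialWord a) (x : Word a n) → Dec (Matches p x)
  matches? p x = decidable compat? p (toList x)

  χ : ∀ {n} → PartialWord a → Word a n → ℕ
  χ p x = if does (matches? p x) then 1 else 0

  χ-yes : ∀ {n} p (x : Word a n) → Matches p x → χ p x ≡ 1
  χ-yes p x m = cong (if_then 1 else 0) (dec-true (matches? p x) m)

  χ-no : ∀ {n} p (x : Word a n) → ¬ Matches p x → χ p x ≡ 0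
  χ-no p x ¬m = cong (if_then 1 else 0) (dec-false (matches? p x) ¬m)

  ∑ʷ-χ : ∀ {n} (p : PartialWord a) → length p ≡ n → ∑ʷ n (χ p) ≡ a ^ diamonds p
  ∑ʷ-χ []            refl = refl
  ∑ʷ-χ (nothing ∷ p) refl = begin
    ∑[ c < a ] ∑ʷ (length p) (χ p)  ≡⟨ sum-cong-≗ {a} (λ _ → ∑ʷ-χ p refl) ⟩
    ∑[ c < a ] (a ^ diamonds p)     ≡⟨ ∑-const a (a ^ diamonds p) ⟩
    a ^ diamonds (nothing ∷ p)      ∎
  ∑ʷ-χ (just b ∷ p)  refl = begin
    ∑[ c < a ] ∑ʷ (length p) (λ x → χ (just b ∷ p) (c ∷ x))  ≡⟨ ∑-single _ b other-letter ⟩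
    ∑ʷ (length p) (λ x → χ (just b ∷ p) (b ∷ x))             ≡⟨ ∑ʷ-cong (length p) same-letter ⟩
    ∑ʷ (length p) (χ p)                                       ≡⟨ ∑ʷ-χ p refl ⟩
    a ^ diamonds p                                            ∎
    where
    other-letter : ∀ c → c ≢ b → ∑ʷ (length p) (λ x → χ (just b ∷ p) (c ∷ x)) ≡ 0
    other-letter c c≢b = begin
      ∑ʷ (length p) (λ x → χ (just b ∷ p) (c ∷ x))  ≡⟨ ∑ʷ-cong (length p) mismatch ⟩
      ∑ʷ (length p) (λ _ → 0)                        ≡⟨ ∑ʷ-const (length p) 0 ⟩
      a ^ length p * 0                               ≡⟨ *-zeroʳ (a ^ length p) ⟩
      0                                              ∎
      where
      mismatch : ∀ x → χ (just b ∷ p) (c ∷ x) ≡ 0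
      mismatch x = χ-no (just b ∷ p) (c ∷ x) λ { (b≡c ∷ _) → c≢b (sym b≡c) }
    -- On a cons, does (matches? …) computes to does (compat? m c) ∧ does (matches? p x).
    same-letter : ∀ x → χ (just b ∷ p) (b ∷ x) ≡ χ p x
    same-letter x = cong (λ t → if t ∧ does (matches? p x) then 1 else 0) (dec-true (b ≟ b) refl)

  ExactCover : ∀ {m} n → (Fin m → PartialWord a) → Set
  ExactCover {m} n ps = (x : Word a n) → ∑[ i < m ] χ (ps i) x ≡ 1

  exactCover⇒∑a^diamonds≡a^n : ∀ {m n} (ps : Fin m → PartialWord a) → (∀ i → length (ps i) ≡ n) →
                                ExactCover n ps → ∑[ i < m ] (a ^ diamonds (ps i)) ≡ a ^ n
  exactCover⇒∑a^diamonds≡a^n {m} {n} ps length≡n cover = begin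
    ∑[ i < m ] (a ^ diamonds (ps i))     ≡⟨ sum-cong-≗ {m} (λ i → ∑ʷ-χ (ps i) (length≡n i)) ⟨
    ∑[ i < m ] ∑ʷ n (χ (ps i))           ≡⟨ ∑-∑ʷ-comm n (χ ∘ ps) ⟩
    ∑ʷ n (λ x → ∑[ i < m ] χ (ps i) x)  ≡⟨ ∑ʷ-cong n cover ⟩
    ∑ʷ n (λ _ → 1)                       ≡⟨ ∑ʷ-const n 1 ⟩
    a ^ n * 1                            ≡⟨ *-identityʳ (a ^ n) ⟩
    a ^ n                                ∎

  windows : ∀ n (w : PartialWord a) → Fin (suc (length w ∸ n)) → PartialWord a
  windows n w i = window n w (toℕ i)

  windows-fit : ∀ {n} (w : PartialWord a) → n ≤ length w →
                (i : Fin (suc (length w ∸ n))) → toℕ i + n ≤ length w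
  windows-fit w n≤N i = m<1+o∸n⇒m+n≤o n≤N (toℕ<n i)

  universal⇒exactCover : ∀ {n} w → Universal a n w → ExactCover n (windows n w)
  universal⇒exactCover {n} w universal x with universal x
  ... | i , (i+n≤N , matches) , unique = trans (∑-single _ i′ others) at-i′
    where
    i<positions : i < suc (length w ∸ n)
    i<positions = m+n≤o⇒m<1+o∸n i+n≤N
    i′ : Fin (suc (length w ∸ n))
    i′ = fromℕ< i<positions
    at-i′ : χ (windows n w i′) x ≡ 1
    at-i′ = χ-yes _ x (subst (λ k → Matches (window n w k) x) (sym (toℕ-fromℕ< i<positions)) matches)
    others : ∀ j → j ≢ i′ → χ (windows n w j) x ≡ 0
    others j j≢i′ = χ-no _ x λ m →
      let j≡i = unique (toℕ j) (windows-fit w (m+n≤o⇒n≤o i i+n≤N) j , m)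
      in j≢i′ (toℕ-injective (trans j≡i (sym (toℕ-fromℕ< i<positions))))

  universal⇒windows-count : ∀ {n d} (w : PartialWord a) → n ≤ length w → Universal a n w →
                            DiamondicityIs a n w d → suc (length w ∸ n) * a ^ d ≡ a ^ n
  universal⇒windows-count {n} {d} w n≤N universal diamondicity = begin
    positions * a ^ d
      ≡⟨ ∑-const positions (a ^ d) ⟨
    ∑[ i < positions ] (a ^ d)
      ≡⟨ sum-cong-≗ {positions} (cong (a ^_) ∘ diamondicity-at) ⟨
    ∑[ i < positions ] (a ^ diamonds (windows n w i))
      ≡⟨ exactCover⇒∑a^diamonds≡a^n (windows n w) length-at cover ⟩
    a ^ n
      ∎
    where
    positions : ℕ
    positions = suc (length w ∸ n)
    diamondicity-at : ∀ i → diamonds (windows n w i) ≡ d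
    diamondicity-at i = diamondicity (toℕ i) (windows-fit w n≤N i)
    length-at : ∀ i → length (windows n w i) ≡ n
    length-at i = length-window n w (toℕ i) (windows-fit w n≤N i)
    cover : ExactCover n (windows n w)
    cover = universal⇒exactCover w universal

corollary4p3 : (a n d : ℕ) → 1 ≤ a → 1 ≤ n → (w : PartialWord a) →
    Universal a n w → DiamondicityIs a n w d →
    length w ≡ a ^ (n ∸ d) + n ∸ 1
corollary4p3 (suc a) n d _ _ w universal diamondicity = begin
  length w                    ≡⟨ m∸n+n≡m n≤N ⟨
  suc (length w ∸ n) + n ∸ 1  ≡⟨ cong (λ m → m + n ∸ 1) windows≡a^[n∸d] ⟩
  suc a ^ (n ∸ d) + n ∸ 1     ∎
  where
  n≤N : n ≤ length w
  n≤N = universal⇒n≤length universal (replicate n fzero)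
  d≤n : d ≤ n
  d≤n = diamondicity⇒d≤n n≤N diamondicity
  windows≡a^[n∸d] : suc (length w ∸ n) ≡ suc a ^ (n ∸ d)
  windows≡a^[n∸d] = m*a^d≡a^n⇒m≡a^[n∸d] (suc a) d≤n (universal⇒windows-count w n≤N universal diamondicity)
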